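{- Let $M$ be a matroid without loops and without coloops and let $e$ be an element of its ground set. Suppose that \[ T(M\setminus e;2,0)\cdot T(M\setminus e;0,2)\geq\frac{4}{3}\cdot T(M\setminus e;1,1)^2 \quad\text{and}\quad T(M/e;2,0)\cdot T(M/e;0,2)\geq\frac{4}{3}\cdot T(M/e;1,1)^2. \] Then $T(M;2,0)\cdot T(M;0,2)\geq\frac{4}{3}\cdot T(M;1,1)^2$.
   Context: $T(M;x,y)=\sum_{A\subseteq E}(x-1)^{r(E)-r(A)}(y-1)^{|A|-r(A)}$ is the Tutte polynomial of a matroid $M$ on $E$ with rank function $r$. $M\setminus e$ and $M/e$ denote deletion and contraction of $e$. -}

module Defs where

open import Data.Nat as ℕ using (ℕ; zero; suc; _∸_; _≤_)
open import Data.Integer as ℤ using (ℤ; +_; _-_; _*_; _^_)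
open import Data.Fin using (Fin)
open import Data.Fin.Subset using (Subset; _⊆_; _∪_; _∩_; ∣_∣; ⁅_⁆; ⊤; ⊥) renaming (_-_ to _∖_)
open import Data.Vec using (Vec; []; _∷_; insertAt)
open import Data.Bool using (Bool; true; false)
open import Data.List using (List; []; _∷_; map; _++_; foldr)
open import Relation.Binary.PropositionalEquality using (_≡_; _≢_)
open import Data.Empty renaming (⊥ to ⊥₀)
open import Relation.Nullary using (¬_)

record Matroid (n : ℕ) : Set where
  field
    r          : Subset n → ℕ
    r-bounded  : ∀ A → r A ≤ ∣ A ∣
    r-mono     : ∀ A B → A ⊆ B → r A ≤ r B
    r-submod   : ∀ A B → r (A ∪ B) ℕ.+ r (A ∩ B) ≤ r A ℕ.+ r B
open Matroid public

IsLoop : ∀ {n} → Matroid n → Fin n → Set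
IsLoop M e = r M ⁅ e ⁆ ≡ 0

IsColoop : ∀ {n} → Matroid n → Fin n → Set
IsColoop M e = r M (⊤ ∖ e) ≢ r M ⊤

Loopless : ∀ {n} → Matroid n → Set
Loopless M = ∀ e → ¬ IsLoop M e

Coloopless : ∀ {n} → Matroid n → Set
Coloopless M = ∀ e → ¬ IsColoop M e

-- Embedding of subsets of E \ {e} (identified with Fin n) into E = Fin (suc n).
embed : ∀ {n} → Fin (suc n) → Subset n → Subset (suc n)
embed e A = insertAt A e false

deletion : ∀ {n} → Matroid (suc n) → Fin (suc n) → (Subset n → ℕ)
deletion M e A = r M (embed e A)

contraction : ∀ {n} → Matroid (suc n) → Fin (suc n) → (Subset n → ℕ)
contraction M e A = r M (embed e A ∪ ⁅ e ⁆) ∸ r M ⁅ e ⁆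

subsets : (n : ℕ) → List (Subset n)
subsets zero    = [] ∷ []
subsets (suc n) = map (true ∷_) (subsets n) ++ map (false ∷_) (subsets n)

sumℤ : List ℤ → ℤ
sumℤ = foldr ℤ._+_ (+ 0)

-- Tutte polynomial of a rank function on Fin n, evaluated at integers x y:
-- T(x,y) = Σ_{A ⊆ E} (x-1)^{r(E)-r(A)} (y-1)^{|A|-r(A)}   (with 0^0 = 1).
tutte : ∀ {n} → (Subset n → ℕ) → ℤ → ℤ → ℤ
tutte {n} r x y =
  sumℤ (map (λ A → ((x - + 1) ^ (r ⊤ ∸ r A)) * ((y - + 1) ^ (∣ A ∣ ∸ r A)))
            (subsets n))

-- T(2,0)·T(0,2) ≥ (4/3)·T(1,1)², written (after multiplying by 3) over ℤ.
TutteIneq : ∀ {n} → (Subset n → ℕ) → Set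
TutteIneq r =
  (+ 4) * (tutte r (+ 1) (+ 1) ^ 2)
    ℤ.≤ (+ 3) * (tutte r (+ 2) (+ 0) * tutte r (+ 0) (+ 2))

-- Deletion–contraction gives T(M) = T(M/e) + T(M∖e) when e is neither a loop nor a
-- coloop, so it suffices that the triples (a, b, c) of nonnegative integers with
-- 4c² ≤ 3ab are closed under addition. Expanding (c + c′)² this reduces to the cross
-- term 8cc′ ≤ 3(ab′ + a′b), which holds after squaring:
-- 64c²c′² ≤ 4·(3ab)(3a′b′) ≤ 9(ab′ + a′b)², the last step being AM–GM.
-- The nonnegativity of the Tutte evaluations involved holds for every matroid at
-- nonnegative integer points, by induction using the loop, coloop and
-- deletion–contraction recurrences.

module Submission where

open import Defs
open import Data.Nat as ℕ using (ℕ; zero; suc; _∸_; z≤n; s≤s)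
import Data.Nat.Properties as ℕP
open import Data.Nat.Properties using (≤-trans; ≤-reflexive; ≤-antisym)
open import Data.Fin using (Fin; zero; suc)
open import Data.Integer using (ℤ; +_; -[1+_]; 0ℤ; _+_; _-_; _*_; _^_; _≤_; +≤+; nonNegative)
open import Data.Integer.Properties
  using (≤-refl; pos-*; drop‿+≤+; +-mono-≤; *-monoˡ-≤-nonNeg; i≤i+j; *-identityʳ; +-identityˡ; +-assoc;
         *-assoc; *-zeroʳ; *-distribˡ-+; +-commutativeSemigroup; module ≤-Reasoning)
open import Algebra.Properties.CommutativeSemigroup +-commutativeSemigroup using (interchange)
open import Data.Integer.Tactic.RingSolver using (solve-∀)
open import Data.List using ([]; _∷_; map; _++_)
open import Data.List.Properties using (map-++; map-∘)
open import Data.Vec using (_∷_; insertAt; here; there)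
open import Data.Bool using (Bool; true; false; _∨_; _∧_)
open import Data.Bool.Properties using (∨-identityʳ)
open import Data.Fin.Subset using (Subset; _⊆_; _∪_; _∩_; ∣_∣; ⁅_⁆; ⊤) renaming (_-_ to _∖_)
open import Data.Fin.Subset.Properties
  using (p─⊥≡p; ∪-identityʳ; ∪-zeroʳ; ∩-identityʳ; drop-∷-⊆; ⊆⊤; p⊆p∪q; q⊆p∪q; ∣⁅x⁆∣≡1)
open import Data.Empty using (⊥-elim)
open import Function using (_∘_)
open import Relation.Binary.PropositionalEquality
open import Relation.Nullary using (yes; no; ¬_)
open import Relation.Nullary.Decidable using (¬?; decidable-stable)

∸-mono-+-≤ : ∀ k {u v x y} → k ℕ.≤ u → k ℕ.≤ v → k ℕ.≤ x → k ℕ.≤ y →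
  u ℕ.+ v ℕ.≤ x ℕ.+ y → (u ∸ k) ℕ.+ (v ∸ k) ℕ.≤ (x ∸ k) ℕ.+ (y ∸ k)
∸-mono-+-≤ zero    _ _ _ _ le = le
∸-mono-+-≤ (suc k) {suc u} {suc v} {suc x} {suc y} (s≤s k≤u) (s≤s k≤v) (s≤s k≤x) (s≤s k≤y) le =
  ∸-mono-+-≤ k k≤u k≤v k≤x k≤y
    (ℕ.s≤s⁻¹ (subst₂ ℕ._≤_ (ℕP.+-suc u v) (ℕP.+-suc x y) (ℕ.s≤s⁻¹ le)))

m∸n≡[m∸1]∸[n∸1] : ∀ m {n} → 1 ℕ.≤ n → m ∸ n ≡ (m ∸ 1) ∸ (n ∸ 1)
m∸n≡[m∸1]∸[n∸1] m {suc n} _ = sym (ℕP.∸-+-assoc m 1 n)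

*-mono-≤-nonNeg : ∀ {i j k l} → 0ℤ ≤ i → 0ℤ ≤ k → i ≤ j → k ≤ l → i * k ≤ j * l
*-mono-≤-nonNeg {+ m} {+ n} {+ p} {+ q} (+≤+ _) (+≤+ _) (+≤+ m≤n) (+≤+ p≤q) =
  subst₂ _≤_ (pos-* m p) (pos-* n q) (+≤+ (ℕP.*-mono-≤ m≤n p≤q))

0≤i*j : ∀ {i j} → 0ℤ ≤ i → 0ℤ ≤ j → 0ℤ ≤ i * j
0≤i*j 0≤i 0≤j = *-mono-≤-nonNeg ≤-refl ≤-refl 0≤i 0≤j

0≤i*i : ∀ i → 0ℤ ≤ i * i
0≤i*i (+ m)    = 0≤i*j {+ m} {+ m} (+≤+ z≤n) (+≤+ z≤n)
0≤i*i -[1+ m ] = +≤+ z≤n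

i^2≡i*i : ∀ i → i ^ 2 ≡ i * i
i^2≡i*i i = cong (i *_) (*-identityʳ i)

i*i≤j*j⇒i≤j : ∀ {i j} → 0ℤ ≤ i → 0ℤ ≤ j → i * i ≤ j * j → i ≤ j
i*i≤j*j⇒i≤j {+ m} {+ n} _ _ i*i≤j*j with m ℕ.≤? n
... | yes m≤n = +≤+ m≤n
... | no m≰n  = ⊥-elim (ℕP.<⇒≱ (ℕP.*-mono-< n<m n<m)
                 (drop‿+≤+ (subst₂ _≤_ (sym (pos-* m m)) (sym (pos-* n n)) i*i≤j*j)))
  where n<m = ℕP.≰⇒> m≰n

cross-term-≤ : ∀ {a b c a′ b′ c′} →
  0ℤ ≤ a → 0ℤ ≤ b → 0ℤ ≤ c → 0ℤ ≤ a′ → 0ℤ ≤ b′ → 0ℤ ≤ c′ →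
  + 4 * (c * c) ≤ + 3 * (a * b) → + 4 * (c′ * c′) ≤ + 3 * (a′ * b′) →
  + 8 * (c * c′) ≤ + 3 * (a * b′ + a′ * b)
cross-term-≤ {a} {b} {c} {a′} {b′} {c′} 0≤a 0≤b 0≤c 0≤a′ 0≤b′ 0≤c′ ineq ineq′ =
  i*i≤j*j⇒i≤j (0≤i*j {+ 8} (+≤+ z≤n) (0≤i*j 0≤c 0≤c′))
              (0≤i*j {+ 3} (+≤+ z≤n) (+-mono-≤ (0≤i*j 0≤a 0≤b′) (0≤i*j 0≤a′ 0≤b)))
    (begin
      (+ 8 * (c * c′)) * (+ 8 * (c * c′))               ≡⟨ square-8xy c c′ ⟩
      + 4 * ((+ 4 * (c * c)) * (+ 4 * (c′ * c′)))       ≤⟨ *-monoˡ-≤-nonNeg (+ 4)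
                                                             (*-mono-≤-nonNeg (4i² c) (4i² c′) ineq ineq′) ⟩
      + 4 * ((+ 3 * (a * b)) * (+ 3 * (a′ * b′)))       ≤⟨ i≤i+j _ _ {{nonNegative 0≤9d²}} ⟩
      + 4 * ((+ 3 * (a * b)) * (+ 3 * (a′ * b′))) + + 9 * ((a * b′ - a′ * b) * (a * b′ - a′ * b))
                                                        ≡⟨ square-cross a b a′ b′ ⟨
      (+ 3 * (a * b′ + a′ * b)) * (+ 3 * (a * b′ + a′ * b)) ∎)
  where
  open ≤-Reasoning
  0≤9d² : 0ℤ ≤ + 9 * ((a * b′ - a′ * b) * (a * b′ - a′ * b))
  0≤9d² = 0≤i*j {+ 9} (+≤+ z≤n) (0≤i*i (a * b′ - a′ * b))
  4i² : ∀ i → 0ℤ ≤ + 4 * (i * i)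
  4i² i = 0≤i*j {+ 4} {i * i} (+≤+ z≤n) (0≤i*i i)
  square-8xy : ∀ x y → (+ 8 * (x * y)) * (+ 8 * (x * y)) ≡ + 4 * ((+ 4 * (x * x)) * (+ 4 * (y * y)))
  square-8xy = solve-∀
  -- AM–GM: (pq′ + p′q)² = 4(pq)(p′q′) + (pq′ − p′q)², scaled by 9.
  square-cross : ∀ p q p′ q′ → (+ 3 * (p * q′ + p′ * q)) * (+ 3 * (p * q′ + p′ * q)) ≡
    + 4 * ((+ 3 * (p * q)) * (+ 3 * (p′ * q′))) + + 9 * ((p * q′ - p′ * q) * (p * q′ - p′ * q))
  square-cross = solve-∀

4c²≤3ab-superadditive : ∀ {a b c a′ b′ c′} →
  0ℤ ≤ a → 0ℤ ≤ b → 0ℤ ≤ c → 0ℤ ≤ a′ → 0ℤ ≤ b′ → 0ℤ ≤ c′ →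
  + 4 * c ^ 2 ≤ + 3 * (a * b) → + 4 * c′ ^ 2 ≤ + 3 * (a′ * b′) →
  + 4 * (c + c′) ^ 2 ≤ + 3 * ((a + a′) * (b + b′))
4c²≤3ab-superadditive {a} {b} {c} {a′} {b′} {c′} 0≤a 0≤b 0≤c 0≤a′ 0≤b′ 0≤c′ ineq ineq′ = begin
  + 4 * (c + c′) ^ 2                                         ≡⟨ cong (+ 4 *_) (i^2≡i*i (c + c′)) ⟩
  + 4 * ((c + c′) * (c + c′))                                ≡⟨ expand-square c c′ ⟩
  + 4 * (c * c) + + 4 * (c′ * c′) + + 8 * (c * c′)          ≤⟨ +-mono-≤ (+-mono-≤ ineq₁ ineq₁′) cross ⟩
  + 3 * (a * b) + + 3 * (a′ * b′) + + 3 * (a * b′ + a′ * b)  ≡⟨ expand-product a b a′ b′ ⟨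
  + 3 * ((a + a′) * (b + b′))                                ∎
  where
  open ≤-Reasoning
  ineq₁  = subst (λ s → + 4 * s ≤ + 3 * (a * b)) (i^2≡i*i c) ineq
  ineq₁′ = subst (λ s → + 4 * s ≤ + 3 * (a′ * b′)) (i^2≡i*i c′) ineq′
  cross  = cross-term-≤ 0≤a 0≤b 0≤c 0≤a′ 0≤b′ 0≤c′ ineq₁ ineq₁′
  expand-square : ∀ x y → + 4 * ((x + y) * (x + y)) ≡ + 4 * (x * x) + + 4 * (y * y) + + 8 * (x * y)
  expand-square = solve-∀
  expand-product : ∀ p q p′ q′ →
    + 3 * ((p + p′) * (q + q′)) ≡ + 3 * (p * q) + + 3 * (p′ * q′) + + 3 * (p * q′ + p′ * q)
  expand-product = solve-∀

sumℤ-++ : ∀ xs ys → sumℤ (xs ++ ys) ≡ sumℤ xs + sumℤ ys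
sumℤ-++ []       ys = sym (+-identityˡ _)
sumℤ-++ (x ∷ xs) ys = trans (cong (λ s → x + s) (sumℤ-++ xs ys)) (sym (+-assoc x _ _))

sumℤ-map-cong : ∀ {A : Set} {f g : A → ℤ} → (∀ a → f a ≡ g a) → ∀ xs →
  sumℤ (map f xs) ≡ sumℤ (map g xs)
sumℤ-map-cong f≡g []       = refl
sumℤ-map-cong f≡g (x ∷ xs) = cong₂ _+_ (f≡g x) (sumℤ-map-cong f≡g xs)

sumℤ-map-* : ∀ {A : Set} k (f : A → ℤ) xs → sumℤ (map (λ a → k * f a) xs) ≡ k * sumℤ (map f xs)
sumℤ-map-* k f []       = sym (*-zeroʳ k)
sumℤ-map-* k f (x ∷ xs) = trans (cong (λ s → k * f x + s) (sumℤ-map-* k f xs)) (sym (*-distribˡ-+ k (f x) _))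

sumSubsets : (n : ℕ) → (Subset n → ℤ) → ℤ
sumSubsets n f = sumℤ (map f (subsets n))

sumSubsets-cong : ∀ n {f g : Subset n → ℤ} → (∀ A → f A ≡ g A) → sumSubsets n f ≡ sumSubsets n g
sumSubsets-cong n f≡g = sumℤ-map-cong f≡g (subsets n)

sumSubsets-* : ∀ n k (f : Subset n → ℤ) → sumSubsets n (λ A → k * f A) ≡ k * sumSubsets n f
sumSubsets-* n k f = sumℤ-map-* k f (subsets n)

sumSubsets-∷ : ∀ n f →
  sumSubsets (suc n) f ≡ sumSubsets n (λ A → f (true ∷ A)) + sumSubsets n (λ A → f (false ∷ A))
sumSubsets-∷ n f = begin
  sumℤ (map f (map (true ∷_) (subsets n) ++ map (false ∷_) (subsets n)))
    ≡⟨ cong sumℤ (map-++ f (map (true ∷_) (subsets n)) _) ⟩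
  sumℤ (map f (map (true ∷_) (subsets n)) ++ map f (map (false ∷_) (subsets n)))
    ≡⟨ sumℤ-++ (map f (map (true ∷_) (subsets n))) _ ⟩
  sumℤ (map f (map (true ∷_) (subsets n))) + sumℤ (map f (map (false ∷_) (subsets n)))
    ≡⟨ sym (cong₂ _+_ (cong sumℤ (map-∘ (subsets n))) (cong sumℤ (map-∘ (subsets n)))) ⟩
  sumSubsets n (λ A → f (true ∷ A)) + sumSubsets n (λ A → f (false ∷ A)) ∎
  where open ≡-Reasoning

sumSubsets-insertAt : ∀ n (e : Fin (suc n)) f →
  sumSubsets (suc n) f ≡
  sumSubsets n (λ A → f (insertAt A e true)) + sumSubsets n (λ A → f (insertAt A e false))
sumSubsets-insertAt n       zero    f = sumSubsets-∷ n f
sumSubsets-insertAt (suc n) (suc e) f = begin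
  sumSubsets (suc (suc n)) f
    ≡⟨ sumSubsets-∷ (suc n) f ⟩
  sumSubsets (suc n) (λ A → f (true ∷ A)) + sumSubsets (suc n) (λ A → f (false ∷ A))
    ≡⟨ cong₂ _+_ (sumSubsets-insertAt n e (λ A → f (true ∷ A)))
                 (sumSubsets-insertAt n e (λ A → f (false ∷ A))) ⟩
  (part true true + part true false) + (part false true + part false false)
    ≡⟨ interchange (part true true) (part true false) (part false true) (part false false) ⟩
  (part true true + part false true) + (part true false + part false false)
    ≡⟨ sym (cong₂ _+_ (sumSubsets-∷ n _) (sumSubsets-∷ n _)) ⟩
  sumSubsets (suc n) (λ A → f (insertAt A (suc e) true)) +
  sumSubsets (suc n) (λ A → f (insertAt A (suc e) false)) ∎
  where
  open ≡-Reasoning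
  part : Bool → Bool → ℤ
  part b c = sumSubsets n (λ A → f (b ∷ insertAt A e c))

∣insertAt-false∣ : ∀ {n} (A : Subset n) e → ∣ insertAt A e false ∣ ≡ ∣ A ∣
∣insertAt-false∣ A           zero    = refl
∣insertAt-false∣ (true ∷ A)  (suc e) = cong suc (∣insertAt-false∣ A e)
∣insertAt-false∣ (false ∷ A) (suc e) = ∣insertAt-false∣ A e

∣insertAt-true∣ : ∀ {n} (A : Subset n) e → ∣ insertAt A e true ∣ ≡ suc ∣ A ∣
∣insertAt-true∣ A           zero    = refl
∣insertAt-true∣ (true ∷ A)  (suc e) = cong suc (∣insertAt-true∣ A e)
∣insertAt-true∣ (false ∷ A) (suc e) = ∣insertAt-true∣ A e

insertAt-⊤-true : ∀ {n} (e : Fin (suc n)) → insertAt ⊤ e true ≡ ⊤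
insertAt-⊤-true         zero    = refl
insertAt-⊤-true {suc n} (suc e) = cong (true ∷_) (insertAt-⊤-true e)

insertAt-⊤-false : ∀ {n} (e : Fin (suc n)) → insertAt ⊤ e false ≡ ⊤ ∖ e
insertAt-⊤-false         zero    = cong (false ∷_) (sym (p─⊥≡p ⊤))
insertAt-⊤-false {suc n} (suc e) = cong (true ∷_) (insertAt-⊤-false e)

insertAt-∪ : ∀ {n} (A B : Subset n) e b c → insertAt A e b ∪ insertAt B e c ≡ insertAt (A ∪ B) e (b ∨ c)
insertAt-∪ A       B       zero    b c = refl
insertAt-∪ (x ∷ A) (y ∷ B) (suc e) b c = cong ((x ∨ y) ∷_) (insertAt-∪ A B e b c)

insertAt-∩ : ∀ {n} (A B : Subset n) e b c → insertAt A e b ∩ insertAt B e c ≡ insertAt (A ∩ B) e (b ∧ c)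
insertAt-∩ A       B       zero    b c = refl
insertAt-∩ (x ∷ A) (y ∷ B) (suc e) b c = cong ((x ∧ y) ∷_) (insertAt-∩ A B e b c)

insertAt-false-∪-⁅⁆ : ∀ {n} (A : Subset n) e → insertAt A e false ∪ ⁅ e ⁆ ≡ insertAt A e true
insertAt-false-∪-⁅⁆ A       zero    = cong (true ∷_) (∪-identityʳ A)
insertAt-false-∪-⁅⁆ (x ∷ A) (suc e) = cong₂ _∷_ (∨-identityʳ x) (insertAt-false-∪-⁅⁆ A e)

insertAt-mono-⊆ : ∀ {n} {A B : Subset n} e b → A ⊆ B → insertAt A e b ⊆ insertAt B e b
insertAt-mono-⊆ zero b A⊆B here = here
insertAt-mono-⊆ zero b A⊆B (there x∈) = there (A⊆B x∈)
insertAt-mono-⊆ {A = _ ∷ _} {_ ∷ _} (suc e) b A⊆B here with A⊆B here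
... | here = here
insertAt-mono-⊆ {A = _ ∷ _} {_ ∷ _} (suc e) b A⊆B (there x∈) = there (insertAt-mono-⊆ e b (drop-∷-⊆ A⊆B) x∈)

tutteMonomial : ℤ → ℤ → ℕ → ℕ → ℤ
tutteMonomial x y p q = (x - + 1) ^ p * (y - + 1) ^ q

tutteTerm : ∀ {n} → (Subset n → ℕ) → ℤ → ℤ → Subset n → ℤ
tutteTerm ρ x y A = tutteMonomial x y (ρ ⊤ ∸ ρ A) (∣ A ∣ ∸ ρ A)

tutteMonomial-sucˡ : ∀ x y p q → tutteMonomial x y (suc p) q ≡ (x - + 1) * tutteMonomial x y p q
tutteMonomial-sucˡ x y p q = *-assoc (x - + 1) ((x - + 1) ^ p) ((y - + 1) ^ q)

tutteMonomial-sucʳ : ∀ x y p q → tutteMonomial x y p (suc q) ≡ (y - + 1) * tutteMonomial x y p q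
tutteMonomial-sucʳ x y p q = swap-front ((x - + 1) ^ p) (y - + 1) ((y - + 1) ^ q)
  where
  swap-front : ∀ a b c → a * (b * c) ≡ b * (a * c)
  swap-front = solve-∀

module _ {n} (M : Matroid (suc n)) (e : Fin (suc n)) where

  private
    ρ : Subset (suc n) → ℕ
    ρ = r M

    infix 10 _⁺ _⁻
    _⁺ _⁻ : Subset n → Subset (suc n)
    A ⁺ = insertAt A e true
    A ⁻ = insertAt A e false

    ρ⁺≡ρ[⁻∪⁅e⁆] : ∀ A → ρ (A ⁺) ≡ ρ (A ⁻ ∪ ⁅ e ⁆)
    ρ⁺≡ρ[⁻∪⁅e⁆] A = cong ρ (sym (insertAt-false-∪-⁅⁆ A e))

  ρ⁅e⁆≤1 : ρ ⁅ e ⁆ ℕ.≤ 1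
  ρ⁅e⁆≤1 = subst (ρ ⁅ e ⁆ ℕ.≤_) (∣⁅x⁆∣≡1 e) (r-bounded M ⁅ e ⁆)

  ρ⁻≤ρ⁺ : ∀ A → ρ (A ⁻) ℕ.≤ ρ (A ⁺)
  ρ⁻≤ρ⁺ A = subst (ρ (A ⁻) ℕ.≤_) (sym (ρ⁺≡ρ[⁻∪⁅e⁆] A)) (r-mono M _ _ (p⊆p∪q ⁅ e ⁆))

  ρ⁅e⁆≤ρ⁺ : ∀ A → ρ ⁅ e ⁆ ℕ.≤ ρ (A ⁺)
  ρ⁅e⁆≤ρ⁺ A = subst (ρ ⁅ e ⁆ ℕ.≤_) (sym (ρ⁺≡ρ[⁻∪⁅e⁆] A)) (r-mono M _ _ (q⊆p∪q (A ⁻) ⁅ e ⁆))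

  ρ⁺≤ρ⁻+ρ⁅e⁆ : ∀ A → ρ (A ⁺) ℕ.≤ ρ (A ⁻) ℕ.+ ρ ⁅ e ⁆
  ρ⁺≤ρ⁻+ρ⁅e⁆ A = begin
    ρ (A ⁺)                                  ≡⟨ ρ⁺≡ρ[⁻∪⁅e⁆] A ⟩
    ρ (A ⁻ ∪ ⁅ e ⁆)                          ≤⟨ ℕP.m≤m+n _ _ ⟩
    ρ (A ⁻ ∪ ⁅ e ⁆) ℕ.+ ρ (A ⁻ ∩ ⁅ e ⁆)      ≤⟨ r-submod M (A ⁻) ⁅ e ⁆ ⟩
    ρ (A ⁻) ℕ.+ ρ ⁅ e ⁆                      ∎
    where open ℕP.≤-Reasoning

  ρ⁺≤1+ρ⁻ : ∀ A → ρ (A ⁺) ℕ.≤ suc (ρ (A ⁻))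
  ρ⁺≤1+ρ⁻ A = ≤-trans (ρ⁺≤ρ⁻+ρ⁅e⁆ A)
    (≤-trans (ℕP.+-monoʳ-≤ (ρ (A ⁻)) ρ⁅e⁆≤1) (≤-reflexive (ℕP.+-comm (ρ (A ⁻)) 1)))

  ρ⁻≤∣A∣ : ∀ A → ρ (A ⁻) ℕ.≤ ∣ A ∣
  ρ⁻≤∣A∣ A = subst (ρ (A ⁻) ℕ.≤_) (∣insertAt-false∣ A e) (r-bounded M (A ⁻))

  ρ⁻≤ρ⊤⁻ : ∀ A → ρ (A ⁻) ℕ.≤ ρ (⊤ ⁻)
  ρ⁻≤ρ⊤⁻ A = r-mono M _ _ (insertAt-mono-⊆ e false ⊆⊤)

  ρ⊤⁺ : ρ (⊤ ⁺) ≡ ρ ⊤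
  ρ⊤⁺ = cong ρ (insertAt-⊤-true e)

  ρ⊤⁻ : ρ (⊤ ⁻) ≡ ρ (⊤ ∖ e)
  ρ⊤⁻ = cong ρ (insertAt-⊤-false e)

  ρ⁻-submod : ∀ A B → ρ ((A ∪ B) ⁻) ℕ.+ ρ ((A ∩ B) ⁻) ℕ.≤ ρ (A ⁻) ℕ.+ ρ (B ⁻)
  ρ⁻-submod A B = subst₂ (λ A∪B A∩B → ρ A∪B ℕ.+ ρ A∩B ℕ.≤ ρ (A ⁻) ℕ.+ ρ (B ⁻))
    (insertAt-∪ A B e false false) (insertAt-∩ A B e false false) (r-submod M (A ⁻) (B ⁻))

  ρ⁺-submod : ∀ A B → ρ ((A ∪ B) ⁺) ℕ.+ ρ ((A ∩ B) ⁺) ℕ.≤ ρ (A ⁺) ℕ.+ ρ (B ⁺)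
  ρ⁺-submod A B = subst₂ (λ A∪B A∩B → ρ A∪B ℕ.+ ρ A∩B ℕ.≤ ρ (A ⁺) ℕ.+ ρ (B ⁺))
    (insertAt-∪ A B e true true) (insertAt-∩ A B e true true) (r-submod M (A ⁺) (B ⁺))

  deletionMatroid : Matroid n
  deletionMatroid = record
    { r         = deletion M e
    ; r-bounded = ρ⁻≤∣A∣
    ; r-mono    = λ A B A⊆B → r-mono M _ _ (insertAt-mono-⊆ e false A⊆B)
    ; r-submod  = ρ⁻-submod
    }

  contraction≡ρ⁺∸ρ⁅e⁆ : ∀ A → contraction M e A ≡ ρ (A ⁺) ∸ ρ ⁅ e ⁆
  contraction≡ρ⁺∸ρ⁅e⁆ A = cong (λ B → ρ B ∸ ρ ⁅ e ⁆) (insertAt-false-∪-⁅⁆ A e)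

  contractionMatroid : Matroid n
  contractionMatroid = record
    { r         = contraction M e
    ; r-bounded = λ A → subst (ℕ._≤ ∣ A ∣) (sym (contraction≡ρ⁺∸ρ⁅e⁆ A))
                    (ℕP.m≤n+o⇒m∸n≤o _ (ρ ⁅ e ⁆) (≤-trans (ρ⁺≤ρ⁻+ρ⁅e⁆ A)
                      (≤-trans (ℕP.+-monoˡ-≤ (ρ ⁅ e ⁆) (ρ⁻≤∣A∣ A)) (≤-reflexive (ℕP.+-comm ∣ A ∣ _)))))
    ; r-mono    = λ A B A⊆B → subst₂ ℕ._≤_ (sym (contraction≡ρ⁺∸ρ⁅e⁆ A)) (sym (contraction≡ρ⁺∸ρ⁅e⁆ B))
                    (ℕP.∸-monoˡ-≤ (ρ ⁅ e ⁆) (r-mono M _ _ (insertAt-mono-⊆ e true A⊆B)))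
    ; r-submod  = λ A B → subst₂ ℕ._≤_
                    (sym (cong₂ ℕ._+_ (contraction≡ρ⁺∸ρ⁅e⁆ (A ∪ B)) (contraction≡ρ⁺∸ρ⁅e⁆ (A ∩ B))))
                    (sym (cong₂ ℕ._+_ (contraction≡ρ⁺∸ρ⁅e⁆ A) (contraction≡ρ⁺∸ρ⁅e⁆ B)))
                    (∸-mono-+-≤ (ρ ⁅ e ⁆) (ρ⁅e⁆≤ρ⁺ _) (ρ⁅e⁆≤ρ⁺ _) (ρ⁅e⁆≤ρ⁺ _) (ρ⁅e⁆≤ρ⁺ _) (ρ⁺-submod A B))
    }

  tutte-split : ∀ x y → tutte ρ x y ≡
    sumSubsets n (tutteTerm ρ x y ∘ _⁺) + sumSubsets n (tutteTerm ρ x y ∘ _⁻)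
  tutte-split x y = sumSubsets-insertAt n e (tutteTerm ρ x y)

  tutteTerm⁻≡deletion : ρ ⊤ ≡ ρ (⊤ ⁻) → ∀ x y A → tutteTerm ρ x y (A ⁻) ≡ tutteTerm (deletion M e) x y A
  tutteTerm⁻≡deletion ρ⊤≡ρ⊤⁻ x y A =
    cong₂ (λ p q → tutteMonomial x y (p ∸ ρ (A ⁻)) (q ∸ ρ (A ⁻))) ρ⊤≡ρ⊤⁻ (∣insertAt-false∣ A e)

  loop⇒ρ⁺≡ρ⁻ : IsLoop M e → ∀ A → ρ (A ⁺) ≡ ρ (A ⁻)
  loop⇒ρ⁺≡ρ⁻ loop A = ≤-antisym
    (≤-trans (ρ⁺≤ρ⁻+ρ⁅e⁆ A) (≤-reflexive (trans (cong (ρ (A ⁻) ℕ.+_) loop) (ℕP.+-identityʳ _))))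
    (ρ⁻≤ρ⁺ A)

  tutte-loop : IsLoop M e → ∀ x y → tutte ρ x y ≡ y * tutte (deletion M e) x y
  tutte-loop loop x y = begin
    tutte ρ x y
      ≡⟨ tutte-split x y ⟩
    sumSubsets n (tutteTerm ρ x y ∘ _⁺) + sumSubsets n (tutteTerm ρ x y ∘ _⁻)
      ≡⟨ cong₂ _+_ (sumSubsets-cong n term⁺) (sumSubsets-cong n (tutteTerm⁻≡deletion ρ⊤≡ρ⊤⁻ x y)) ⟩
    sumSubsets n (λ A → (y - + 1) * T′ A) + tutte (deletion M e) x y
      ≡⟨ cong (_+ tutte (deletion M e) x y) (sumSubsets-* n (y - + 1) T′) ⟩
    (y - + 1) * tutte (deletion M e) x y + tutte (deletion M e) x y
      ≡⟨ [i-1]*j+j≡i*j y _ ⟩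
    y * tutte (deletion M e) x y ∎
    where
    open ≡-Reasoning
    T′ = tutteTerm (deletion M e) x y
    ρ⊤≡ρ⊤⁻ : ρ ⊤ ≡ ρ (⊤ ⁻)
    ρ⊤≡ρ⊤⁻ = trans (sym ρ⊤⁺) (loop⇒ρ⁺≡ρ⁻ loop ⊤)
    term⁺ : ∀ A → tutteTerm ρ x y (A ⁺) ≡ (y - + 1) * T′ A
    term⁺ A = begin
      tutteMonomial x y (ρ ⊤ ∸ ρ (A ⁺)) (∣ A ⁺ ∣ ∸ ρ (A ⁺))
        ≡⟨ cong₂ (tutteMonomial x y) (cong₂ _∸_ ρ⊤≡ρ⊤⁻ (loop⇒ρ⁺≡ρ⁻ loop A))
                                     (cong₂ _∸_ (∣insertAt-true∣ A e) (loop⇒ρ⁺≡ρ⁻ loop A)) ⟩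
      tutteMonomial x y (ρ (⊤ ⁻) ∸ ρ (A ⁻)) (suc ∣ A ∣ ∸ ρ (A ⁻))
        ≡⟨ cong (tutteMonomial x y (ρ (⊤ ⁻) ∸ ρ (A ⁻))) (ℕP.+-∸-assoc 1 (ρ⁻≤∣A∣ A)) ⟩
      tutteMonomial x y (ρ (⊤ ⁻) ∸ ρ (A ⁻)) (suc (∣ A ∣ ∸ ρ (A ⁻)))
        ≡⟨ tutteMonomial-sucʳ x y (ρ (⊤ ⁻) ∸ ρ (A ⁻)) (∣ A ∣ ∸ ρ (A ⁻)) ⟩
      (y - + 1) * T′ A ∎
    [i-1]*j+j≡i*j : ∀ i j → (i - + 1) * j + j ≡ i * j
    [i-1]*j+j≡i*j = solve-∀

  coloop⇒ρ⊤≡1+ρ⊤⁻ : IsColoop M e → ρ ⊤ ≡ suc (ρ (⊤ ⁻))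
  coloop⇒ρ⊤≡1+ρ⊤⁻ coloop = ≤-antisym
    (subst (ℕ._≤ suc (ρ (⊤ ⁻))) ρ⊤⁺ (ρ⁺≤1+ρ⁻ ⊤))
    (ℕP.≤∧≢⇒< (subst (ρ (⊤ ⁻) ℕ.≤_) ρ⊤⁺ (ρ⁻≤ρ⁺ ⊤)) (coloop ∘ trans (sym ρ⊤⁻)))

  coloop⇒ρ⁺≡1+ρ⁻ : IsColoop M e → ∀ A → ρ (A ⁺) ≡ suc (ρ (A ⁻))
  coloop⇒ρ⁺≡1+ρ⁻ coloop A = ≤-antisym (ρ⁺≤1+ρ⁻ A) (ℕP.+-cancelˡ-≤ (ρ (⊤ ⁻)) _ _ (begin
    ρ (⊤ ⁻) ℕ.+ suc (ρ (A ⁻))           ≡⟨ ℕP.+-suc (ρ (⊤ ⁻)) _ ⟩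
    suc (ρ (⊤ ⁻)) ℕ.+ ρ (A ⁻)           ≡⟨ cong₂ ℕ._+_ (coloop⇒ρ⊤≡1+ρ⊤⁻ coloop) (cong ρ A⁺∩⊤⁻≡A⁻) ⟨
    ρ ⊤ ℕ.+ ρ (A ⁺ ∩ ⊤ ⁻)               ≡⟨ cong (λ B → ρ B ℕ.+ ρ (A ⁺ ∩ ⊤ ⁻)) A⁺∪⊤⁻≡⊤ ⟨
    ρ (A ⁺ ∪ ⊤ ⁻) ℕ.+ ρ (A ⁺ ∩ ⊤ ⁻)     ≤⟨ r-submod M (A ⁺) (⊤ ⁻) ⟩
    ρ (A ⁺) ℕ.+ ρ (⊤ ⁻)                 ≡⟨ ℕP.+-comm (ρ (A ⁺)) _ ⟩
    ρ (⊤ ⁻) ℕ.+ ρ (A ⁺)                 ∎))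
    where
    open ℕP.≤-Reasoning
    A⁺∪⊤⁻≡⊤ : A ⁺ ∪ ⊤ ⁻ ≡ ⊤
    A⁺∪⊤⁻≡⊤ = trans (insertAt-∪ A ⊤ e true false)
                (trans (cong (λ B → insertAt B e true) (∪-zeroʳ A)) (insertAt-⊤-true e))
    A⁺∩⊤⁻≡A⁻ : A ⁺ ∩ ⊤ ⁻ ≡ A ⁻
    A⁺∩⊤⁻≡A⁻ = trans (insertAt-∩ A ⊤ e true false) (cong (λ B → insertAt B e false) (∩-identityʳ A))

  tutte-coloop : IsColoop M e → ∀ x y → tutte ρ x y ≡ x * tutte (deletion M e) x y
  tutte-coloop coloop x y = begin
    tutte ρ x y
      ≡⟨ tutte-split x y ⟩
    sumSubsets n (tutteTerm ρ x y ∘ _⁺) + sumSubsets n (tutteTerm ρ x y ∘ _⁻)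
      ≡⟨ cong₂ _+_ (sumSubsets-cong n term⁺) (sumSubsets-cong n term⁻) ⟩
    tutte (deletion M e) x y + sumSubsets n (λ A → (x - + 1) * T′ A)
      ≡⟨ cong (λ s → tutte (deletion M e) x y + s) (sumSubsets-* n (x - + 1) T′) ⟩
    tutte (deletion M e) x y + (x - + 1) * tutte (deletion M e) x y
      ≡⟨ j+[i-1]*j≡i*j x _ ⟩
    x * tutte (deletion M e) x y ∎
    where
    open ≡-Reasoning
    T′ = tutteTerm (deletion M e) x y
    ρ⊤≡ = coloop⇒ρ⊤≡1+ρ⊤⁻ coloop
    term⁺ : ∀ A → tutteTerm ρ x y (A ⁺) ≡ T′ A
    term⁺ A = cong₂ (tutteMonomial x y) (cong₂ _∸_ ρ⊤≡ (coloop⇒ρ⁺≡1+ρ⁻ coloop A))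
                                        (cong₂ _∸_ (∣insertAt-true∣ A e) (coloop⇒ρ⁺≡1+ρ⁻ coloop A))
    term⁻ : ∀ A → tutteTerm ρ x y (A ⁻) ≡ (x - + 1) * T′ A
    term⁻ A = begin
      tutteMonomial x y (ρ ⊤ ∸ ρ (A ⁻)) (∣ A ⁻ ∣ ∸ ρ (A ⁻))
        ≡⟨ cong₂ (λ p q → tutteMonomial x y (p ∸ ρ (A ⁻)) (q ∸ ρ (A ⁻))) ρ⊤≡ (∣insertAt-false∣ A e) ⟩
      tutteMonomial x y (suc (ρ (⊤ ⁻)) ∸ ρ (A ⁻)) (∣ A ∣ ∸ ρ (A ⁻))
        ≡⟨ cong (λ p → tutteMonomial x y p (∣ A ∣ ∸ ρ (A ⁻))) (ℕP.+-∸-assoc 1 (ρ⁻≤ρ⊤⁻ A)) ⟩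
      tutteMonomial x y (suc (ρ (⊤ ⁻) ∸ ρ (A ⁻))) (∣ A ∣ ∸ ρ (A ⁻))
        ≡⟨ tutteMonomial-sucˡ x y (ρ (⊤ ⁻) ∸ ρ (A ⁻)) (∣ A ∣ ∸ ρ (A ⁻)) ⟩
      (x - + 1) * T′ A ∎
    j+[i-1]*j≡i*j : ∀ i j → j + (i - + 1) * j ≡ i * j
    j+[i-1]*j≡i*j = solve-∀

  tutte-deletion-contraction : ¬ IsLoop M e → ¬ IsColoop M e → ∀ x y →
    tutte ρ x y ≡ tutte (contraction M e) x y + tutte (deletion M e) x y
  tutte-deletion-contraction nonloop noncoloop x y =
    trans (tutte-split x y) (cong₂ _+_ (sumSubsets-cong n term⁺) (sumSubsets-cong n term⁻))
    where
    ρ⁅e⁆≡1 : ρ ⁅ e ⁆ ≡ 1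
    ρ⁅e⁆≡1 = ≤-antisym ρ⁅e⁆≤1 (ℕP.n≢0⇒n>0 nonloop)
    1≤ρ⁺ : ∀ A → 1 ℕ.≤ ρ (A ⁺)
    1≤ρ⁺ A = subst (ℕ._≤ ρ (A ⁺)) ρ⁅e⁆≡1 (ρ⁅e⁆≤ρ⁺ A)
    contraction-rank : ∀ A → contraction M e A ≡ ρ (A ⁺) ∸ 1
    contraction-rank A = trans (contraction≡ρ⁺∸ρ⁅e⁆ A) (cong (ρ (A ⁺) ∸_) ρ⁅e⁆≡1)
    term⁺ : ∀ A → tutteTerm ρ x y (A ⁺) ≡ tutteTerm (contraction M e) x y A
    term⁺ A = begin
      tutteMonomial x y (ρ ⊤ ∸ ρ (A ⁺)) (∣ A ⁺ ∣ ∸ ρ (A ⁺))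
        ≡⟨ cong₂ (tutteMonomial x y) (m∸n≡[m∸1]∸[n∸1] (ρ ⊤) (1≤ρ⁺ A))
             (trans (cong (_∸ ρ (A ⁺)) (∣insertAt-true∣ A e)) (m∸n≡[m∸1]∸[n∸1] (suc ∣ A ∣) (1≤ρ⁺ A))) ⟩
      tutteMonomial x y ((ρ ⊤ ∸ 1) ∸ (ρ (A ⁺) ∸ 1)) (∣ A ∣ ∸ (ρ (A ⁺) ∸ 1))
        ≡⟨ cong₂ (λ p q → tutteMonomial x y (p ∸ q) (∣ A ∣ ∸ q))
             (trans (contraction-rank ⊤) (cong (_∸ 1) ρ⊤⁺)) (contraction-rank A) ⟨
      tutteTerm (contraction M e) x y A ∎
      where open ≡-Reasoning
    term⁻ : ∀ A → tutteTerm ρ x y (A ⁻) ≡ tutteTerm (deletion M e) x y A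
    term⁻ = tutteTerm⁻≡deletion (sym (trans ρ⊤⁻ (decidable-stable (ρ (⊤ ∖ e) ℕ.≟ ρ ⊤) noncoloop))) x y

tutte-nonNeg : ∀ {n} (M : Matroid n) (x y : ℕ) → 0ℤ ≤ tutte (r M) (+ x) (+ y)
tutte-nonNeg {zero} M x y
  rewrite ℕP.n∸n≡0 (r M ⊤) | ℕP.0∸n≡0 (r M ⊤) = +≤+ z≤n
tutte-nonNeg {suc n} M x y with r M ⁅ zero ⁆ ℕ.≟ 0 | ¬? (r M (⊤ ∖ zero) ℕ.≟ r M ⊤)
... | yes loop | _ =
  subst (0ℤ ≤_) (sym (tutte-loop M zero loop (+ x) (+ y)))
  (0≤i*j {+ y} (+≤+ z≤n) (tutte-nonNeg (deletionMatroid M zero) x y))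
... | no _ | yes coloop =
  subst (0ℤ ≤_) (sym (tutte-coloop M zero coloop (+ x) (+ y)))
  (0≤i*j {+ x} (+≤+ z≤n) (tutte-nonNeg (deletionMatroid M zero) x y))
... | no nonloop | no noncoloop =
  subst (0ℤ ≤_) (sym (tutte-deletion-contraction M zero nonloop noncoloop (+ x) (+ y)))
  (+-mono-≤ (tutte-nonNeg (contractionMatroid M zero) x y) (tutte-nonNeg (deletionMatroid M zero) x y))

lemma4p3 : (n : ℕ) (M : Matroid (suc n)) (e : Fin (suc n)) →
    Loopless M → Coloopless M →
    TutteIneq (deletion M e) → TutteIneq (contraction M e) →
    TutteIneq (r M)
lemma4p3 n M e loopless coloopless deletion-ineq contraction-ineq =
  subst₂ (λ c ab → + 4 * c ^ 2 ≤ + 3 * ab)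
    (sym (split (+ 1) (+ 1)))
    (sym (cong₂ _*_ (split (+ 2) (+ 0)) (split (+ 0) (+ 2))))
    (4c²≤3ab-superadditive
      (tutte-nonNeg M/e 2 0) (tutte-nonNeg M/e 0 2) (tutte-nonNeg M/e 1 1)
      (tutte-nonNeg M∖e 2 0) (tutte-nonNeg M∖e 0 2) (tutte-nonNeg M∖e 1 1)
      contraction-ineq deletion-ineq)
  where
  M/e M∖e : Matroid n
  M/e = contractionMatroid M e
  M∖e = deletionMatroid M e
  split : ∀ x y → tutte (r M) x y ≡ tutte (contraction M e) x y + tutte (deletion M e) x y
  split = tutte-deletion-contraction M e (loopless e) (coloopless e)
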